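{- Let $(T,\to)$ be a $\le2$-homogeneous tournament such that for every vertex $x$ the $3$-cycle $C_3$ embeds in the subtournament on $x^+$. Then for every vertex $x$, $C_3$ embeds in the subtournament on $x^-$.
   Context: A tournament is a digraph $(T,\to)$ such that for any distinct $x,y$ exactly one of $x\to y$, $y\to x$ holds. $x^+=\{y: x\to y\}$ and $x^-=\{y:y\to x\}$. $C_3$ is the tournament on $\{a,b,c\}$ with $a\to b\to c\to a$. $(T,\to)$ is $\le2$-homogeneous if every isomorphism between substructures of size at most $2$ extends to an automorphism of $(T,\to)$. (Structures are assumed countable.) -}

module Defs where

open import Level using (Level; _⊔_; suc)
open import Data.Nat using (ℕ)
open import Data.Product using (Σ; ∃; _×_; _,_)
open import Data.Sum using (_⊎_)
open import Relation.Nullary using (¬_)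
open import Relation.Binary.PropositionalEquality using (_≡_; _≢_)
open import Function.Bundles using (_⇔_; Bijection)
open import Function.Definitions using (Injective)
open import Function.Bundles using (Bijection)
open import Relation.Binary.PropositionalEquality using (setoid)

Countable : ∀ {a} → Set a → Set a
Countable A = Σ (A → ℕ) λ f → Injective _≡_ _≡_ f

record IsTournament {a ℓ} (V : Set a) (_⟶_ : V → V → Set ℓ) : Set (a ⊔ ℓ) where
  field
    irrefl   : ∀ x → ¬ (x ⟶ x)
    total    : ∀ x y → x ≢ y → (x ⟶ y) ⊎ (y ⟶ x)
    asym     : ∀ x y → x ⟶ y → ¬ (y ⟶ x)

record Automorphism {a ℓ} (V : Set a) (_⟶_ : V → V → Set ℓ) : Set (a ⊔ ℓ) where
  field
    σ       : V → V
    bij     : Function.Definitions.Bijective {A = V} _≡_ _≡_ σ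
    respect : ∀ x y → (x ⟶ y) ⇔ (σ x ⟶ σ y)

-- ≤2-homogeneity: every isomorphism between substructures of size ≤ 2
-- extends to an automorphism.  Size 0: trivial (identity).
record Is≤2Homogeneous {a ℓ} (V : Set a) (_⟶_ : V → V → Set ℓ) : Set (a ⊔ ℓ) where
  field
    hom₁ : ∀ a b → Σ (Automorphism V _⟶_) λ α → Automorphism.σ α a ≡ b
    hom₂ : ∀ a b c d → a ≢ b → c ≢ d →
           (a ⟶ b) ⇔ (c ⟶ d) → (b ⟶ a) ⇔ (d ⟶ c) →
           Σ (Automorphism V _⟶_) λ α →
             (Automorphism.σ α a ≡ c) × (Automorphism.σ α b ≡ d)

C₃EmbedsIn : ∀ {a ℓ p} {V : Set a} → (V → V → Set ℓ) → (V → Set p) → Set (a ⊔ ℓ ⊔ p)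
C₃EmbedsIn {V = V} _⟶_ P =
  Σ V λ u → Σ V λ v → Σ V λ w →
    P u × P v × P w × u ≢ v × v ≢ w × u ≢ w ×
    (u ⟶ v) × (v ⟶ w) × (w ⟶ u)

Out : ∀ {a ℓ} {V : Set a} → (V → V → Set ℓ) → V → V → Set ℓ
Out _⟶_ x y = x ⟶ y

In : ∀ {a ℓ} {V : Set a} → (V → V → Set ℓ) → V → V → Set ℓ
In _⟶_ x y = y ⟶ x

{-# OPTIONS --safe #-}
module Submission where

-- Let u → v → w → u be a 3-cycle in x⁺.  Homogeneity gives an automorphism σ
-- with σ x = u and σ u = v; put s = σ v and t = σ w.  Then u → s, u → t,
-- v → s, s → t, t → v, and however the edges between w and s, t are oriented,
-- one of s, t, w receives a 3-cycle.  Vertex-transitivity moves it to x.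

open import Defs
open import Data.Empty using (⊥-elim)
open import Data.Product using (Σ; ∃; _×_; _,_)
open import Data.Sum using (inj₁; inj₂)
open import Relation.Binary.PropositionalEquality using (_≡_; _≢_; refl; sym; subst)
open import Function.Bundles using (Equivalence; mk⇔)

module _ {a ℓ} {V : Set a} {_⟶_ : V → V → Set ℓ} (T : IsTournament V _⟶_) where
  open IsTournament T

  ⟶⇒≢ : ∀ {p q} → p ⟶ q → p ≢ q
  ⟶⇒≢ {p} pq refl = irrefl p pq

  ⟶⇒≢⁻¹ : ∀ {p q} → p ⟶ q → q ≢ p
  ⟶⇒≢⁻¹ pq q≡p = ⟶⇒≢ pq (sym q≡p)

  path₂-ends-≢ : ∀ {p q r} → p ⟶ q → q ⟶ r → p ≢ r
  path₂-ends-≢ {q = q} {r} pq qr refl = asym r q pq qr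

  cycle-into⇒C₃EmbedsIn⁻ : ∀ {z p q r} → p ⟶ z → q ⟶ z → r ⟶ z →
                            p ⟶ q → q ⟶ r → r ⟶ p → C₃EmbedsIn _⟶_ (In _⟶_ z)
  cycle-into⇒C₃EmbedsIn⁻ pz qz rz pq qr rp =
    _ , _ , _ , pz , qz , rz , ⟶⇒≢ pq , ⟶⇒≢ qr , ⟶⇒≢⁻¹ rp , pq , qr , rp

  five-vertex-configuration⇒C₃EmbedsIn⁻ :
    ∀ {u v w s t} → u ⟶ v → v ⟶ w → w ⟶ u →
    u ⟶ s → u ⟶ t → v ⟶ s → s ⟶ t → t ⟶ v →
    ∃ λ z → C₃EmbedsIn _⟶_ (In _⟶_ z)
  five-vertex-configuration⇒C₃EmbedsIn⁻ {w = w} {s} {t} uv vw wu us ut vs st tv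
    with total w s (path₂-ends-≢ wu us)
  ... | inj₁ ws = s , cycle-into⇒C₃EmbedsIn⁻ us vs ws uv vw wu
  ... | inj₂ sw with total w t (λ w≡t → path₂-ends-≢ tv vw (sym w≡t))
  ...   | inj₁ wt = t , cycle-into⇒C₃EmbedsIn⁻ st wt ut sw wu us
  ...   | inj₂ tw = w , cycle-into⇒C₃EmbedsIn⁻ vw sw tw vs st tv

module _ {a ℓ} {V : Set a} {_⟶_ : V → V → Set ℓ} where

  Automorphism-preserves : (α : Automorphism V _⟶_) → ∀ {p q} →
                           p ⟶ q → Automorphism.σ α p ⟶ Automorphism.σ α q
  Automorphism-preserves α {p} {q} = Equivalence.to (Automorphism.respect α p q)

  Automorphism-preserves-C₃EmbedsIn⁻ :
    IsTournament V _⟶_ → (α : Automorphism V _⟶_) → ∀ {z} →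
    C₃EmbedsIn _⟶_ (In _⟶_ z) → C₃EmbedsIn _⟶_ (In _⟶_ (Automorphism.σ α z))
  Automorphism-preserves-C₃EmbedsIn⁻ T α (_ , _ , _ , pz , qz , rz , _ , _ , _ , pq , qr , rp) =
    cycle-into⇒C₃EmbedsIn⁻ T (↑ pz) (↑ qz) (↑ rz) (↑ pq) (↑ qr) (↑ rp)
    where
      ↑ : ∀ {p q} → p ⟶ q → Automorphism.σ α p ⟶ Automorphism.σ α q
      ↑ = Automorphism-preserves α

  C₃EmbedsIn⁻-transitive : IsTournament V _⟶_ → Is≤2Homogeneous V _⟶_ →
                           ∀ {z} x → C₃EmbedsIn _⟶_ (In _⟶_ z) → C₃EmbedsIn _⟶_ (In _⟶_ x)
  C₃EmbedsIn⁻-transitive T H {z} x C₃ with Is≤2Homogeneous.hom₁ H z x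
  ... | α , refl = Automorphism-preserves-C₃EmbedsIn⁻ T α C₃

  shift-along-edge : IsTournament V _⟶_ → Is≤2Homogeneous V _⟶_ →
                     ∀ {x u v} → x ⟶ u → u ⟶ v →
                     Σ (Automorphism V _⟶_) λ α →
                       (Automorphism.σ α x ≡ u) × (Automorphism.σ α u ≡ v)
  shift-along-edge T H xu uv =
    Is≤2Homogeneous.hom₂ H _ _ _ _ (⟶⇒≢ T xu) (⟶⇒≢ T uv)
      (mk⇔ (λ _ → uv) (λ _ → xu))
      (mk⇔ (λ ux → ⊥-elim (asym _ _ xu ux)) (λ vu → ⊥-elim (asym _ _ uv vu)))
    where open IsTournament T

lemma3p4 : ∀ {a ℓ} (V : Set a) (_⟶_ : V → V → Set ℓ) →
    Countable V → IsTournament V _⟶_ → Is≤2Homogeneous V _⟶_ →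
    (∀ x → C₃EmbedsIn _⟶_ (Out _⟶_ x)) →
    ∀ x → C₃EmbedsIn _⟶_ (In _⟶_ x)
lemma3p4 V _⟶_ _ T H C₃⁺ x
  with C₃⁺ x
... | u , v , w , xu , xv , xw , _ , _ , _ , uv , vw , wu
  with shift-along-edge T H xu uv
... | α , refl , σu≡v
  with five-vertex-configuration⇒C₃EmbedsIn⁻ T uv vw wu
         (↑ xv) (↑ xw) (subst (_⟶ σ v) σu≡v (↑ uv)) (↑ vw) (subst (σ w ⟶_) σu≡v (↑ wu))
  where
    σ : V → V
    σ = Automorphism.σ α
    ↑ : ∀ {p q} → p ⟶ q → σ p ⟶ σ q
    ↑ = Automorphism-preserves α
... | _ , C₃⁻ = C₃EmbedsIn⁻-transitive T H x C₃⁻
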